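{- Let $\mathcal S$ be a Büchi automaton over $\Sigma$, let $a\in\mathit{Ag}$, $e\in\mathit{AP}\setminus\mathit{AP}_a$, and $D\in\mathbb N$. Suppose $\mathcal S$ is $D$-P-diagnosable wrt. $a$ and $e$. Let $\mathcal K$ be any $(\mathcal S,\mathsf Pe)$-knowledge monitor for $a$, and define $f\colon\Sigma_a^*\to\{0,1\}$ by $f(u)=1$ iff $u\in L(\mathcal K)$. Then $f$ is a $D$-P-diagnoser for $\mathcal S$ (wrt. $a$ and $e$).
   Context: Fix a finite set $\mathit{AP}$ of atomic propositions, $\Sigma=2^{\mathit{AP}}$, and a finite set $\mathit{Ag}$ of agents with observable propositions $\mathit{AP}_a\subseteq\mathit{AP}$ and $\Sigma_a=2^{\mathit{AP}_a}$. $\mathit{obs}_a(\sigma)=\sigma\cap\mathit{AP}_a$, extended letterwise to words; $w_{\le k}$ is the length-$k$ prefix of $w$. A Büchi automaton $\mathcal S$ over $\Sigma$ accepts $L(\mathcal S)\subseteq\Sigma^\omega$ (infinite words with a run from the initial state visiting accepting states infinitely often). $\mathit{Pref}^+(L(\mathcal S))$ is the set of nonempty finite prefixes of words of $L(\mathcal S)$, and $\mathit{Obs}_a(\mathcal S)=\{\mathit{obs}_a(u)\mid u\in\mathit{Pref}^+(L(\mathcal S))\}$. Semantics for $w=\sigma_1\sigma_2\cdots\in L(\mathcal S)$, $k\ge1$: $e$ holds at $k$ iff $e\in\sigma_k$; $\mathsf X^D\varphi$ holds at $k$ iff $\varphi$ holds at $k+D$; $\mathsf P\varphi$ holds at $k$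 iff $\varphi$ holds at some $1\le j\le k$; $\mathsf G\varphi$ holds at $k$ iff $\varphi$ holds at all $j\ge k$; $\mathsf K_a\varphi$ holds at $k$ iff $\varphi$ holds at $k$ in every $w'\in L(\mathcal S)$ with $\mathit{obs}_a(w_{\le k})=\mathit{obs}_a(w'_{\le k})$. $\mathcal S\models\varphi$ means $\varphi$ holds at position 1 of every $w\in L(\mathcal S)$. $\mathcal S$ is $D$-P-diagnosable wrt. $a,e$ if $\mathcal S\models\mathsf G(e\to\mathsf X^D\mathsf K_a\mathsf Pe)$. For $u\in\mathit{Obs}_a(\mathcal S)$ of length $k$, $\mathcal S,u\models_a\varphi$ iff $\varphi$ holds at position $k$ of every $w\in L(\mathcal S)$ with $\mathit{obs}_a(w_{\le k})=u$. An $(\mathcal S,\mathsf Pe)$-knowledge monitor for $a$ is a DFA $\mathcal K$ over $\Sigma_a$ such that for all $u\in\mathit{Obs}_a(\mathcal S)$: $u\in L(\mathcal K)$ iff $\mathcal S,u\models_a\mathsf Pe$. A finite word $\sigma_1\cdots\sigma_n$ is faulty if $e\in\sigma_i$ for some $i$, fault-free otherwise. A $D$-P-diagnoser for $\mathcal S$ (wrt. $a,e$) is a function $f\colon\Sigma_a^*\to\{0,1\}$ such that (Detection) for all faulty $u\in\Sigma^+$ and all $v\in\Sigma^*$ with $|v|=D$ and $uv\in\mathit{Pref}^+(L(\mathcal S))$, $f(\mathit{obs}_a(uv))=1$; and (No false alarms) for all fault-free $u\in\mathit{Pref}^+(L(\mathcal S))$, $f(\mathit{obs}_a(u))=0$.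 -}

module Defs where

open import Data.Nat using (ℕ; zero; suc; _+_; _≤_; _∸_)
open import Data.Fin using (Fin)
open import Data.Fin.Subset using (Subset; _∈_; _∉_; _∩_)
open import Data.Bool using (Bool; true; false)
open import Data.List using (List; []; _∷_; length; map; _++_; foldl)
open import Data.List.Relation.Unary.Any using (Any)
open import Data.Product using (Σ; ∃; ∃-syntax; _×_; _,_)
open import Relation.Binary.PropositionalEquality using (_≡_; _≢_)
open import Relation.Nullary using (¬_)
open import Function.Bundles using (_⇔_)

-- Conventions: AP = Fin n, a letter of Σ = 2^AP is a Subset n.
-- Agents: Ag = Fin k, with observable propositions APof a : Subset n.
-- Infinite words σ₁σ₂⋯ are functions w : ℕ → Subset n with w i = σ_{i+1}
-- (internal index i corresponds to paper position i+1).

Word∞ : ℕ → Set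
Word∞ n = ℕ → Subset n

FinWord : ℕ → Set
FinWord n = List (Subset n)

record Buchi (n : ℕ) : Set where
  field
    m    : ℕ
    init : Fin m
    Δ    : Fin m → Subset n → Fin m → Bool
    acc  : Fin m → Bool

module _ {n : ℕ} (S : Buchi n) where
  open Buchi S

  AcceptingRun : Word∞ n → (ℕ → Fin m) → Set
  AcceptingRun w r =
    (r 0 ≡ init)
    × (∀ i → Δ (r i) (w i) (r (suc i)) ≡ true)
    × (∀ i → ∃[ j ] (i ≤ j × acc (r j) ≡ true))

  InL : Word∞ n → Set
  InL w = ∃[ r ] AcceptingRun w r

prefix : {n : ℕ} → Word∞ n → ℕ → FinWord n
prefix w zero = []
prefix w (suc k) = w 0 ∷ prefix (λ i → w (suc i)) k

Pref⁺ : {n : ℕ} → Buchi n → FinWord n → Set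
Pref⁺ S u = (u ≢ []) × ∃[ w ] (InL S w × prefix w (length u) ≡ u)

obsL : {n : ℕ} → Subset n → Subset n → Subset n
obsL A σ = σ ∩ A

obsW : {n : ℕ} → Subset n → FinWord n → FinWord n
obsW A u = map (obsL A) u

data Formula (n k : ℕ) : Set where
  prop : Fin n → Formula n k
  _⇒_  : Formula n k → Formula n k → Formula n k
  X    : ℕ → Formula n k → Formula n k
  P    : Formula n k → Formula n k
  G    : Formula n k → Formula n k
  K    : Fin k → Formula n k → Formula n k

module _ {n k : ℕ} (APof : Fin k → Subset n) (S : Buchi n) where

  -- holds w i φ : φ holds at (paper) position i+1 of w
  holds : Word∞ n → ℕ → Formula n k → Set
  holds w i (prop e) = e ∈ w i
  holds w i (φ ⇒ ψ) = holds w i φ → holds w i ψ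
  holds w i (X D φ) = holds w (i + D) φ
  holds w i (P φ) = ∃[ j ] (j ≤ i × holds w j φ)
  holds w i (G φ) = ∀ j → i ≤ j → holds w j φ
  holds w i (K a φ) =
    ∀ w' → InL S w' →
      obsW (APof a) (prefix w (suc i)) ≡ obsW (APof a) (prefix w' (suc i)) →
      holds w' i φ

  Models : Formula n k → Set
  Models φ = ∀ w → InL S w → holds w 0 φ

  Diagnosable : Fin k → Fin n → ℕ → Set
  Diagnosable a e D = Models (G (prop e ⇒ X D (K a (P (prop e)))))

  ObsSet : Fin k → FinWord n → Set
  ObsSet a u = ∃[ v ] (Pref⁺ S v × obsW (APof a) v ≡ u)

  -- S, u ⊨_a φ   (u of length |u| ≥ 1; paper position |u| = internal index |u| ∸ 1)
  ModelsObs : Fin k → FinWord n → Formula n k → Set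
  ModelsObs a u φ =
    ∀ w → InL S w → obsW (APof a) (prefix w (length u)) ≡ u → holds w (length u ∸ 1) φ

-- DFA over Σ_a; letters of Σ_a = 2^{AP_a} are represented as Subset n
-- (only subsets of AP_a are ever fed to it).
record DFA (n : ℕ) : Set where
  field
    q  : ℕ
    q0 : Fin q
    δ  : Fin q → Subset n → Fin q
    F  : Fin q → Bool

-- indicator of L(K): true = 1, false = 0
accepts : {n : ℕ} → DFA n → FinWord n → Bool
accepts 𝒦 u = DFA.F 𝒦 (foldl (DFA.δ 𝒦) (DFA.q0 𝒦) u)

Faulty : {n : ℕ} → Fin n → FinWord n → Set
Faulty e u = Any (e ∈_) u

module _ {n k : ℕ} (APof : Fin k → Subset n) (S : Buchi n) where

  KnowledgeMonitor : Fin k → Fin n → DFA n → Set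
  KnowledgeMonitor a e 𝒦 =
    ∀ u → ObsSet APof S a u → (accepts 𝒦 u ≡ true ⇔ ModelsObs APof S a u (P (prop e)))

  Detection : Fin k → Fin n → ℕ → (FinWord n → Bool) → Set
  Detection a e D f =
    ∀ u v → u ≢ [] → Faulty e u → length v ≡ D → Pref⁺ S (u ++ v) →
      f (obsW (APof a) (u ++ v)) ≡ true

  NoFalseAlarms : Fin k → Fin n → (FinWord n → Bool) → Set
  NoFalseAlarms a e f =
    ∀ u → ¬ Faulty e u → Pref⁺ S u → f (obsW (APof a) u) ≡ false

  Diagnoser : Fin k → Fin n → ℕ → (FinWord n → Bool) → Set
  Diagnoser a e D f = Detection a e D f × NoFalseAlarms a e f

-- If a fault occurs at position i of a run w, diagnosability makes every run that the agent
-- cannot tell apart from w up to position i + D contain the fault by then, so D steps later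
-- the agent knows P e and the monitor accepts. Conversely, if the monitor accepts the
-- observation of a prefix of w, then P e holds at its last position in every compatible run,
-- in particular in w itself, so the prefix is faulty.
module Submission where

open import Defs
open import Data.Nat using (ℕ; suc; _+_; _≤_; _<_; _∸_; z≤n; s≤s)
open import Data.Nat.Properties using (≤-trans; +-monoˡ-≤; m≤m+n)
open import Data.Fin using (Fin)
open import Data.Fin.Subset using (Subset; _∈_; _∉_)
open import Data.Bool using (true; false)
open import Data.List using (List; []; _∷_; length; take; _++_)
open import Data.List.Properties using (length-++; length-map; take-map)
open import Data.List.Relation.Unary.Any using (Any; here; there)
open import Data.Product using (∃-syntax; _×_; _,_)
open import Data.Empty using (⊥-elim)
open import Relation.Binary.PropositionalEquality
open import Relation.Unary using (Pred)
open import Function.Bundles using (Equivalence)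

private
  variable
    n k : ℕ

tail∞ : Word∞ n → Word∞ n
tail∞ w i = w (suc i)

take-prefix : (w : Word∞ n) {m L : ℕ} → m ≤ L → take m (prefix w L) ≡ prefix w m
take-prefix w z≤n       = refl
take-prefix w (s≤s m≤L) = cong (w 0 ∷_) (take-prefix (tail∞ w) m≤L)

take-length-++ : ∀ {a} {A : Set a} (u v : List A) → take (length u) (u ++ v) ≡ u
take-length-++ []      v = refl
take-length-++ (x ∷ u) v = cong (x ∷_) (take-length-++ u v)

prefix-++⁻ˡ : (w : Word∞ n) (u v : FinWord n) →
  prefix w (length (u ++ v)) ≡ u ++ v → prefix w (length u) ≡ u
prefix-++⁻ˡ w u v eq = begin
  prefix w (length u)                          ≡⟨ take-prefix w length-u≤ ⟨
  take (length u) (prefix w (length (u ++ v))) ≡⟨ cong (take (length u)) eq ⟩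
  take (length u) (u ++ v)                     ≡⟨ take-length-++ u v ⟩
  u                                            ∎
  where
  open ≡-Reasoning
  length-u≤ : length u ≤ length (u ++ v)
  length-u≤ = subst (length u ≤_) (sym (length-++ u)) (m≤m+n (length u) (length v))

obsW-prefix-≤ : (A : Subset n) (w w' : Word∞ n) {m L : ℕ} → m ≤ L →
  obsW A (prefix w L) ≡ obsW A (prefix w' L) → obsW A (prefix w m) ≡ obsW A (prefix w' m)
obsW-prefix-≤ A w w' {m} m≤L eq = begin
  obsW A (prefix w m)             ≡⟨ cong (obsW A) (take-prefix w m≤L) ⟨
  obsW A (take m (prefix w _))    ≡⟨ take-map m (prefix w _) ⟨
  take m (obsW A (prefix w _))    ≡⟨ cong (take m) eq ⟩
  take m (obsW A (prefix w' _))   ≡⟨ take-map m (prefix w' _) ⟩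
  obsW A (take m (prefix w' _))   ≡⟨ cong (obsW A) (take-prefix w' m≤L) ⟩
  obsW A (prefix w' m)            ∎
  where open ≡-Reasoning

Any-prefix⁻ : ∀ {p} {P : Pred (Subset n) p} (w : Word∞ n) (L : ℕ) →
  Any P (prefix w L) → ∃[ j ] (j < L × P (w j))
Any-prefix⁻ w (suc L) (here p)  = 0 , s≤s z≤n , p
Any-prefix⁻ w (suc L) (there p) with Any-prefix⁻ (tail∞ w) L p
... | j , j<L , pj = suc j , s≤s j<L , pj

Any-prefix⁺ : ∀ {p} {P : Pred (Subset n) p} (w : Word∞ n) {j L : ℕ} →
  j < L → P (w j) → Any P (prefix w L)
Any-prefix⁺ w {0}     (s≤s _)   pj = here pj
Any-prefix⁺ w {suc j} (s≤s j<L) pj = there (Any-prefix⁺ (tail∞ w) j<L pj)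

module _ (APof : Fin k → Subset n) (S : Buchi n) (a : Fin k) where

  -- ModelsObs reads the position off the length of the observation; these restate it
  -- with the length of the underlying word.
  modelsObs-obsW⁺ : (φ : Formula n k) (u : FinWord n) →
    (∀ w → InL S w → obsW (APof a) (prefix w (length u)) ≡ obsW (APof a) u →
      holds APof S w (length u ∸ 1) φ) →
    ModelsObs APof S a (obsW (APof a) u) φ
  modelsObs-obsW⁺ φ u h rewrite length-map (obsL (APof a)) u = h

  modelsObs-obsW⁻ : (φ : Formula n k) (u : FinWord n) →
    ModelsObs APof S a (obsW (APof a) u) φ →
    ∀ w → InL S w → obsW (APof a) (prefix w (length u)) ≡ obsW (APof a) u →
      holds APof S w (length u ∸ 1) φ
  modelsObs-obsW⁻ φ u h rewrite length-map (obsL (APof a)) u = h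

  module _ (e : Fin n) where

    knows-fault-after-delay : (D : ℕ) → Diagnosable APof S a e D →
      (u v : FinWord n) → Faulty e u → length v ≡ D → Pref⁺ S (u ++ v) →
      ModelsObs APof S a (obsW (APof a) (u ++ v)) (P (prop e))
    knows-fault-after-delay D diag u v fault |v|≡D (_ , w , w∈L , w≡uv)
      with Any-prefix⁻ w (length u) (subst (Any (e ∈_)) (sym (prefix-++⁻ˡ w u v w≡uv)) fault)
    ... | i , i<|u| , e∈wi = modelsObs-obsW⁺ (P (prop e)) (u ++ v) λ w' w'∈L obs≡ →
      let j , j≤i+D , e∈w'j = diag w w∈L i z≤n e∈wi w' w'∈L
            (obsW-prefix-≤ (APof a) w w' i+D<|uv|
              (trans (cong (obsW (APof a)) w≡uv) (sym obs≡)))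
      in j , ≤-trans j≤i+D (pred-≤ i+D<|uv|) , e∈w'j
      where
      i+D<|uv| : suc (i + D) ≤ length (u ++ v)
      i+D<|uv| = subst (suc (i + D) ≤_) (sym (trans (length-++ u) (cong (length u +_) |v|≡D)))
                   (+-monoˡ-≤ D i<|u|)
      pred-≤ : ∀ {x y} → suc x ≤ y → x ≤ y ∸ 1
      pred-≤ (s≤s x≤y) = x≤y

    knows-fault⇒Faulty : (u : FinWord n) → Pref⁺ S u →
      ModelsObs APof S a (obsW (APof a) u) (P (prop e)) → Faulty e u
    knows-fault⇒Faulty u (u≢[] , w , w∈L , w≡u) knows
      with modelsObs-obsW⁻ (P (prop e)) u knows w w∈L (cong (obsW (APof a)) w≡u)
    ... | j , j≤|u|-1 , e∈wj = subst (Any (e ∈_)) w≡u (Any-prefix⁺ w (j<|u| u u≢[] j≤|u|-1) e∈wj)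
      where
      -- non-emptiness excludes the truncated 0 ∸ 1
      j<|u| : ∀ {x} (xs : FinWord n) → xs ≢ [] → x ≤ length xs ∸ 1 → x < length xs
      j<|u| []      []≢[] _  = ⊥-elim ([]≢[] refl)
      j<|u| (_ ∷ _) _     x≤ = s≤s x≤

proposition3p9 : {n k : ℕ} (APof : Fin k → Subset n) (S : Buchi n)
    (a : Fin k) (e : Fin n) (D : ℕ) →
    e ∉ APof a →
    Diagnosable APof S a e D →
    (𝒦 : DFA n) → KnowledgeMonitor APof S a e 𝒦 →
    Diagnoser APof S a e D (accepts 𝒦)
proposition3p9 APof S a e D _ diag 𝒦 monitor = detection , no-false-alarms
  where
  detection : Detection APof S a e D (accepts 𝒦)
  detection u v _ fault |v|≡D uv∈Pref =
    Equivalence.from (monitor _ (u ++ v , uv∈Pref , refl))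
      (knows-fault-after-delay APof S a e D diag u v fault |v|≡D uv∈Pref)

  no-false-alarms : NoFalseAlarms APof S a e (accepts 𝒦)
  no-false-alarms u fault-free u∈Pref with accepts 𝒦 (obsW (APof a) u) in accepted
  ... | false = refl
  ... | true  = ⊥-elim (fault-free (knows-fault⇒Faulty APof S a e u u∈Pref
                  (Equivalence.to (monitor _ (u , u∈Pref , refl)) accepted)))
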